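{- Let $G$ be a rooted $k$-tree, $v$ a vertex of $G$, and let $w$ and $w'$ be the $i$-parent and the $i'$-parent of $v$, respectively, for some $i<i'$. Then $w'$ is the $i''$-parent of $w$ for some $i''\le i'$.
   Context: Rooted $k$-trees are directed graphs defined recursively: every transitive tournament with at most $k$ vertices is a rooted $k$-tree; and if $G$ is a rooted $k$-tree and $v_1,\ldots,v_k$ are vertices forming a transitive tournament in which $v_1v_2\cdots v_k$ is a directed path, then the directed graph obtained from $G$ by adding a new vertex $v$ and an edge directed from $v$ to $v_i$ for every $i\in[k]$ is also a rooted $k$-tree; in this case $v_i$ is called the $i$-parent of $v$. For vertices of the initial transitive tournament, a vertex with $\ell$ out-neighbors has its out-neighbors labelled as its $1$-parent, $\ldots$, $\ell$-parent so that there is an edge from its $i$-parent to its $i'$-parent for every $i<i'$. -}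

module Defs where

open import Data.Nat using (ℕ; zero; suc; _<_; _≤_)
open import Data.Fin using (Fin; toℕ)
open import Data.Vec using (Vec; lookup; toList)
open import Data.List using (List; []; _∷_; _++_; [_]; map; upTo; downFrom; length)
open import Data.List.Membership.Propositional using (_∈_)
open import Data.List.Relation.Unary.All using (All)
open import Data.Maybe using (Maybe; just; nothing)
open import Data.Product using (Σ; _×_)
open import Data.Sum using (_⊎_)
open import Relation.Nullary using (¬_)
open import Relation.Binary.PropositionalEquality using (_≡_; _≢_)

-- A digraph on vertex set {0,…,n-1} (n = length G), given by the ordered list
-- of out-neighbours ("parents") of every vertex: the j-th entry (0-based) of
-- the list of vertex v is the (j+1)-parent of v.
Graph : Set
Graph = List (List ℕ)

at : {A : Set} → List A → ℕ → Maybe A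
at []       _       = nothing
at (x ∷ xs) zero    = just x
at (x ∷ xs) (suc n) = at xs n

parentsOf : Graph → ℕ → List ℕ
parentsOf G v with at G v
... | just ps = ps
... | nothing = []

Edge : Graph → ℕ → ℕ → Set
Edge G u w = w ∈ parentsOf G u

IsParent : Graph → ℕ → ℕ → ℕ → Set
IsParent G i w v = Σ ℕ λ j → (i ≡ suc j) × (at (parentsOf G v) j ≡ just w)

-- The transitive tournament on m vertices 0,…,m-1, where vertex j has
-- out-neighbours j-1,…,0, listed in this order (so its ℓ-parent has an edge
-- to its ℓ'-parent whenever ℓ < ℓ').
transTournament : ℕ → Graph
transTournament m = map downFrom (upTo m)

TransTournamentPath : {k : ℕ} → Graph → Vec ℕ k → Set
TransTournamentPath {k} G vs =
    ((a b : Fin k) → lookup vs a ≡ lookup vs b → a ≡ b)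
  × ((a b : Fin k) → a ≢ b →
        (Edge G (lookup vs a) (lookup vs b) × ¬ Edge G (lookup vs b) (lookup vs a))
      ⊎ (Edge G (lookup vs b) (lookup vs a) × ¬ Edge G (lookup vs a) (lookup vs b)))
  × ((a b c : Fin k) → Edge G (lookup vs a) (lookup vs b)
                     → Edge G (lookup vs b) (lookup vs c)
                     → Edge G (lookup vs a) (lookup vs c))
  × ((a b : Fin k) → toℕ b ≡ suc (toℕ a) → Edge G (lookup vs a) (lookup vs b))

data RootedKTree (k : ℕ) : Graph → Set where
  base : {m : ℕ} → m ≤ k → RootedKTree k (transTournament m)
  add  : {G : Graph} → RootedKTree k G → (vs : Vec ℕ k)
       → All (_< length G) (toList vs)
       → TransTournamentPath G vs
       → RootedKTree k (G ++ [ toList vs ])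

-- Induction along the construction of G, carrying a stronger invariant: every
-- vertex has at most k parents, each parent has an edge to every later parent,
-- and the proposition itself. The only real case is a newly added vertex v whose
-- parents v₁⋯v_k form a transitive tournament path, with w = v_i and w' = v_{i'}.
-- The edge w → w' makes w' the p-th parent of w for some p. Each later parent
-- v_{i'+1}, …, v_k of v is also a parent of w, and lies after position p in the
-- parent list of w: equality is excluded by distinctness, and an earlier position
-- would give an edge from a later to an earlier vertex of the tournament. So these
-- k − i' vertices occupy distinct positions among the at most k − p positions
-- after p, whence p ≤ i'.

module Submission where

open import Defs
open import Data.Nat using (ℕ; zero; suc; _+_; _∸_; _<_; _≤_; z≤n; s≤s; s≤s⁻¹; _<?_)
open import Data.Nat.Properties
open import Data.Nat.Tactic.RingSolver using (solve-∀)
open import Data.Fin as Fin using (Fin; toℕ; fromℕ<)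
open import Data.Fin.Properties using (toℕ<n; toℕ-fromℕ<; toℕ-injective; injective⇒≤)
open import Data.Vec using (Vec; lookup; toList; []; _∷_)
open import Data.Vec.Properties using (length-toList)
open import Data.List using (List; []; _∷_; _++_; [_]; length; map; downFrom; upTo; applyUpTo)
open import Data.List.Properties using (length-downFrom)
open import Data.List.Membership.Propositional using (_∈_)
open import Data.List.Relation.Unary.Any using (here; there)
open import Data.Maybe as Maybe using (just; nothing; fromMaybe)
open import Data.Maybe.Properties using (just-injective)
open import Data.Product using (Σ; _×_; _,_; proj₁; proj₂)
open import Data.Sum using (_⊎_; inj₁; inj₂)
open import Data.Empty using (⊥-elim)
open import Function using (id; _∘_)
open import Relation.Nullary using (¬_; yes; no)
open import Relation.Binary.PropositionalEquality using (_≡_; refl; sym; trans; cong; subst; module ≡-Reasoning)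
open import Relation.Binary.Definitions using (tri<; tri≈; tri>)

module _ {A : Set} where

  at-subst : {xs ys : List A} {j : ℕ} {x : A} → xs ≡ ys → at xs j ≡ just x → at ys j ≡ just x
  at-subst refl eq = eq

  ∈⇒at : {x : A} {xs : List A} → x ∈ xs → Σ ℕ λ j → at xs j ≡ just x
  ∈⇒at (here refl) = zero , refl
  ∈⇒at (there x∈xs) = let j , eq = ∈⇒at x∈xs in suc j , eq

  at⇒∈ : (xs : List A) {j : ℕ} {x : A} → at xs j ≡ just x → x ∈ xs
  at⇒∈ []       ()
  at⇒∈ (y ∷ xs) {zero}  eq = here (sym (just-injective eq))
  at⇒∈ (y ∷ xs) {suc j} eq = there (at⇒∈ xs eq)

  at⇒< : (xs : List A) {j : ℕ} {x : A} → at xs j ≡ just x → j < length xs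
  at⇒< []       ()
  at⇒< (y ∷ xs) {zero}  _  = s≤s z≤n
  at⇒< (y ∷ xs) {suc j} eq = s≤s (at⇒< xs eq)

  <⇒at : (xs : List A) {j : ℕ} → j < length xs → Σ A λ x → at xs j ≡ just x
  <⇒at (y ∷ xs) {zero}  _         = y , refl
  <⇒at (y ∷ xs) {suc j} (s≤s j<n) = <⇒at xs j<n

  at-++ : (xs ys : List A) {j : ℕ} {x : A} → at xs j ≡ just x → at (xs ++ ys) j ≡ just x
  at-++ []       ys ()
  at-++ (y ∷ xs) ys {zero}  eq = eq
  at-++ (y ∷ xs) ys {suc j} eq = at-++ xs ys eq

  at-∷ʳ : (xs : List A) (y : A) (j : ℕ) →
          at (xs ++ [ y ]) j ≡ at xs j ⊎ at (xs ++ [ y ]) j ≡ just y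
  at-∷ʳ []       y zero    = inj₂ refl
  at-∷ʳ []       y (suc j) = inj₁ refl
  at-∷ʳ (x ∷ xs) y zero    = inj₁ refl
  at-∷ʳ (x ∷ xs) y (suc j) = at-∷ʳ xs y j

  at-applyUpTo : (f : ℕ → A) {n j : ℕ} → j < n → at (applyUpTo f n) j ≡ just (f j)
  at-applyUpTo f {suc n} {zero}  _         = refl
  at-applyUpTo f {suc n} {suc j} (s≤s j<n) = at-applyUpTo (f ∘ suc) j<n

  at-applyUpTo-≥ : (f : ℕ → A) {n j : ℕ} → n ≤ j → at (applyUpTo f n) j ≡ nothing
  at-applyUpTo-≥ f {zero}            _         = refl
  at-applyUpTo-≥ f {suc n} {suc j} (s≤s n≤j) = at-applyUpTo-≥ (f ∘ suc) n≤j

at-map : {A B : Set} (f : A → B) (xs : List A) (j : ℕ) → at (map f xs) j ≡ Maybe.map f (at xs j)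
at-map f []       j       = refl
at-map f (x ∷ xs) zero    = refl
at-map f (x ∷ xs) (suc j) = at-map f xs j

at-downFrom : (a x : ℕ) → at (downFrom (suc (a + x))) a ≡ just x
at-downFrom zero    x = refl
at-downFrom (suc a) x = at-downFrom a x

at-downFrom⁻¹ : (n a x : ℕ) → at (downFrom n) a ≡ just x → suc (a + x) ≡ n
at-downFrom⁻¹ (suc n) zero    x eq = cong suc (just-injective (sym eq))
at-downFrom⁻¹ (suc n) (suc a) x eq = cong suc (at-downFrom⁻¹ n a x eq)

<∸⇒+< : ∀ {m n o} → m < n ∸ o → m + o < n
<∸⇒+< {m} {n} {o} m<n∸o = m≤o∸n⇒m+n≤o (suc m) o≤n m<n∸o
  where
  o≤n : o ≤ n
  o≤n = <⇒≤ (m∸n≢0⇒n<m (λ n∸o≡0 → <⇒≱ m<n∸o (subst (_≤ m) (sym n∸o≡0) z≤n)))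

Distinct : List ℕ → Set
Distinct xs = ∀ {a b x} → at xs a ≡ just x → at xs b ≡ just x → a ≡ b

ForwardEdges : Graph → List ℕ → Set
ForwardEdges G xs = ∀ {a b x y} → a < b → at xs a ≡ just x → at xs b ≡ just y → Edge G x y

NoBackwardEdges : Graph → List ℕ → Set
NoBackwardEdges G xs = ∀ {a b x y} → a < b → at xs a ≡ just x → at xs b ≡ just y → ¬ Edge G y x

tail-embedding⇒≤ : (xs ys : List ℕ) {q p : ℕ} → Distinct xs →
  (∀ {c y} → q < c → at xs c ≡ just y → Σ ℕ λ r → p < r × at ys r ≡ just y) →
  length xs ∸ suc q ≤ length ys ∸ suc p
tail-embedding⇒≤ xs ys {q} {p} distinct embed = injective⇒≤ {f = slot} slot-injective
  where
  index : Fin (length xs ∸ suc q) → ℕ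
  index i = toℕ i + suc q

  entry : ∀ i → Σ ℕ λ y → at xs (index i) ≡ just y
  entry i = <⇒at xs (<∸⇒+< (toℕ<n i))

  image : ∀ i → Σ ℕ λ r → p < r × at ys r ≡ just (proj₁ (entry i))
  image i = embed (m≤n+m (suc q) (toℕ i)) (proj₂ (entry i))

  r : Fin (length xs ∸ suc q) → ℕ
  r i = proj₁ (image i)

  p<r : ∀ i → p < r i
  p<r i = proj₁ (proj₂ (image i))

  slot : Fin (length xs ∸ suc q) → Fin (length ys ∸ suc p)
  slot i = fromℕ< (∸-monoˡ-< (at⇒< ys (proj₂ (proj₂ (image i)))) (p<r i))

  slot-injective : ∀ {i j} → slot i ≡ slot j → i ≡ j
  slot-injective {i} {j} eq = toℕ-injective (+-cancelʳ-≡ (suc q) _ _ same-index)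
    where
    same-r : r i ≡ r j
    same-r = ∸-cancelʳ-≡ (p<r i) (p<r j)
      (trans (sym (toℕ-fromℕ< _)) (trans (cong toℕ eq) (toℕ-fromℕ< _)))

    same-entry : proj₁ (entry i) ≡ proj₁ (entry j)
    same-entry = just-injective (trans (sym (proj₂ (proj₂ (image i))))
      (trans (cong (at ys) same-r) (proj₂ (proj₂ (image j)))))

    same-index : index i ≡ index j
    same-index = distinct (proj₂ (entry i))
      (subst (λ y → at xs (index j) ≡ just y) (sym same-entry) (proj₂ (entry j)))

ParentAt : Graph → ℕ → ℕ → ℕ → Set
ParentAt G u j x = at (parentsOf G u) j ≡ just x

parentsOf-at : (G : Graph) (u : ℕ) → parentsOf G u ≡ fromMaybe [] (at G u)
parentsOf-at G u with at G u
... | just ps = refl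
... | nothing = refl

parentsOf-++ : (G H : Graph) (u : ℕ) {j x : ℕ} → ParentAt G u j x →
               parentsOf (G ++ H) u ≡ parentsOf G u
parentsOf-++ G H u x-at with at G u in eq
... | just ps = trans (parentsOf-at (G ++ H) u) (cong (fromMaybe []) (at-++ G H eq))
parentsOf-++ G H u () | nothing

parentsOf-∷ʳ : (G : Graph) (l : List ℕ) (u : ℕ) →
               parentsOf (G ++ [ l ]) u ≡ parentsOf G u ⊎ parentsOf (G ++ [ l ]) u ≡ l
parentsOf-∷ʳ G l u with at-∷ʳ G l u
... | inj₁ eq = inj₁ (trans (parentsOf-at (G ++ [ l ]) u)
                        (trans (cong (fromMaybe []) eq) (sym (parentsOf-at G u))))
... | inj₂ eq = inj₂ (trans (parentsOf-at (G ++ [ l ]) u) (cong (fromMaybe []) eq))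

parentAt-++ : (G H : Graph) {u j x : ℕ} → ParentAt G u j x → ParentAt (G ++ H) u j x
parentAt-++ G H x-at = at-subst (sym (parentsOf-++ G H _ x-at)) x-at

edge-++ : (G H : Graph) {x y : ℕ} → Edge G x y → Edge (G ++ H) x y
edge-++ G H {x} {y} y∈ = subst (y ∈_) (sym (parentsOf-++ G H x (proj₂ (∈⇒at y∈)))) y∈

LaterParentsInherited : Graph → Set
LaterParentsInherited G = ∀ {u a b x y} → a < b → ParentAt G u a x → ParentAt G u b y →
                     Σ ℕ λ p → p ≤ b × ParentAt G x p y

record WellLabelled (k : ℕ) (G : Graph) : Set where
  field
    parents-length≤ : ∀ u → length (parentsOf G u) ≤ k
    parents-forward : ∀ u → ForwardEdges G (parentsOf G u)
    parents-inherited : LaterParentsInherited G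

module TransitiveTournament (m : ℕ) where

  T : Graph
  T = transTournament m

  parentsOf-via-upTo : ∀ u → parentsOf T u ≡ fromMaybe [] (Maybe.map downFrom (at (upTo m) u))
  parentsOf-via-upTo u = trans (parentsOf-at T u) (cong (fromMaybe []) (at-map downFrom (upTo m) u))

  parentsOf-< : ∀ {u} → u < m → parentsOf T u ≡ downFrom u
  parentsOf-< {u} u<m =
    trans (parentsOf-via-upTo u) (cong (fromMaybe [] ∘ Maybe.map downFrom) (at-applyUpTo id u<m))

  parentsOf-≥ : ∀ {u} → m ≤ u → parentsOf T u ≡ []
  parentsOf-≥ {u} m≤u =
    trans (parentsOf-via-upTo u) (cong (fromMaybe [] ∘ Maybe.map downFrom) (at-applyUpTo-≥ id m≤u))

  parentAt-downFrom : ∀ {u a x} → ParentAt T u a x → u < m × suc (a + x) ≡ u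
  parentAt-downFrom {u} {a} {x} x-at with u <? m
  ... | yes u<m = u<m , at-downFrom⁻¹ u a x (at-subst (parentsOf-< u<m) x-at)
  ... | no u≮m with at-subst (parentsOf-≥ (≮⇒≥ u≮m)) x-at
  ...   | ()

  parentAt-later : ∀ {u a b x y} → a < b → ParentAt T u a x → ParentAt T u b y →
                   ParentAt T x (b ∸ suc a) y
  parentAt-later {_} {a} {b} {x} {y} a<b x-at y-at =
    at-subst (sym (parentsOf-< x<m))
      (subst (λ n → at (downFrom n) (b ∸ suc a) ≡ just y) (sym x≡) (at-downFrom (b ∸ suc a) y))
    where
    open ≡-Reasoning
    u<m = proj₁ (parentAt-downFrom x-at)
    a+x≡u = proj₂ (parentAt-downFrom x-at)

    x<m : x < m
    x<m = <-trans (subst (x <_) a+x≡u (s≤s (m≤n+m x a))) u<m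

    rearrange : ∀ d a y → d + suc a + y ≡ a + suc (d + y)
    rearrange = solve-∀

    x≡ : x ≡ suc (b ∸ suc a + y)
    x≡ = +-cancelˡ-≡ a x _ (begin
      a + x                    ≡⟨ suc-injective (trans a+x≡u (sym (proj₂ (parentAt-downFrom y-at)))) ⟩
      b + y                    ≡⟨ cong (_+ y) (sym (m∸n+n≡m a<b)) ⟩
      b ∸ suc a + suc a + y    ≡⟨ rearrange (b ∸ suc a) a y ⟩
      a + suc (b ∸ suc a + y)  ∎)

  wellLabelled : ∀ {k} → m ≤ k → WellLabelled k T
  wellLabelled {k} m≤k = record
    { parents-length≤   = length≤
    ; parents-forward   = λ u a<b x-at y-at → at⇒∈ _ (parentAt-later a<b x-at y-at)
    ; parents-inherited = λ {_} {a} {b} a<b x-at y-at →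
        b ∸ suc a , m∸n≤m b (suc a) , parentAt-later a<b x-at y-at
    }
    where
    length≤ : ∀ u → length (parentsOf T u) ≤ k
    length≤ u with u <? m
    ... | yes u<m rewrite parentsOf-< u<m | length-downFrom u = ≤-trans (<⇒≤ u<m) m≤k
    ... | no u≮m  rewrite parentsOf-≥ (≮⇒≥ u≮m) = z≤n

at-toList : ∀ {k} (vs : Vec ℕ k) {a x : ℕ} → at (toList vs) a ≡ just x →
            Σ (Fin k) λ i → toℕ i ≡ a × lookup vs i ≡ x
at-toList []       ()
at-toList (v ∷ vs) {zero}  eq = Fin.zero , refl , just-injective eq
at-toList (v ∷ vs) {suc a} eq =
  let i , i≡a , vs[i]≡x = at-toList vs eq in Fin.suc i , cong suc i≡a , vs[i]≡x

module TournamentPath {k : ℕ} (G : Graph) (vs : Vec ℕ k) (path : TransTournamentPath G vs) where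

  private
    lookup-injective = proj₁ path
    oriented         = proj₁ (proj₂ path)
    transitive       = proj₁ (proj₂ (proj₂ path))
    consecutive      = proj₂ (proj₂ (proj₂ path))

  edge-at-distance : ∀ d (i j : Fin k) → toℕ j ≡ suc (d + toℕ i) → Edge G (lookup vs i) (lookup vs j)
  edge-at-distance zero    i j j≡ = consecutive i j j≡
  edge-at-distance (suc d) i j j≡ =
    transitive i c j (edge-at-distance d i c (toℕ-fromℕ< c<k))
      (consecutive c j (trans j≡ (cong suc (sym (toℕ-fromℕ< c<k)))))
    where
    c<k : suc (d + toℕ i) < k
    c<k = <-trans (subst (suc (d + toℕ i) <_) (sym j≡) (n<1+n _)) (toℕ<n j)
    c = fromℕ< c<k

  edge-< : (i j : Fin k) → toℕ i < toℕ j → Edge G (lookup vs i) (lookup vs j)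
  edge-< i j i<j = edge-at-distance (toℕ j ∸ suc (toℕ i)) i j
    (sym (trans (sym (+-suc (toℕ j ∸ suc (toℕ i)) (toℕ i))) (m∸n+n≡m i<j)))

  distinct : Distinct (toList vs)
  distinct x-at x-at′ with at-toList vs x-at | at-toList vs x-at′
  ... | i , refl , vs[i]≡x | j , refl , vs[j]≡x =
    cong toℕ (lookup-injective i j (trans vs[i]≡x (sym vs[j]≡x)))

  forward : ForwardEdges G (toList vs)
  forward a<b x-at y-at with at-toList vs x-at | at-toList vs y-at
  ... | i , refl , refl | j , refl , refl = edge-< i j a<b

  noBackward : NoBackwardEdges G (toList vs)
  noBackward a<b x-at y-at with at-toList vs x-at | at-toList vs y-at
  ... | i , refl , refl | j , refl , refl with oriented i j (λ i≡j → <-irrefl (cong toℕ i≡j) a<b)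
  ...   | inj₁ (_ , ¬back) = ¬back
  ...   | inj₂ (_ , ¬fwd)  = λ _ → ¬fwd (edge-< i j a<b)

module _ (G : Graph) (l : List ℕ) {w w′ j j′ p : ℕ}
         (distinct : Distinct l) (forward : ForwardEdges G l) (noBackward : NoBackwardEdges G l)
         (w-forward : ForwardEdges G (parentsOf G w))
         (j<j′ : j < j′) (w-at : at l j ≡ just w) (w′-at : at l j′ ≡ just w′)
         (w′-parent : ParentAt G w p w′) where

  later-parents-after : ∀ {c y} → j′ < c → at l c ≡ just y → Σ ℕ λ r → p < r × ParentAt G w r y
  later-parents-after {c} j′<c y-at with ∈⇒at (forward (<-trans j<j′ j′<c) w-at y-at)
  ... | r , y-parent with <-cmp p r
  ...   | tri< p<r _ _ = r , p<r , y-parent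
  ...   | tri≈ _ refl _ = ⊥-elim (<-irrefl (distinct w′-at w′-at-c) j′<c)
    where
    w′-at-c : at l c ≡ just w′
    w′-at-c = subst (λ z → at l c ≡ just z) (just-injective (trans (sym y-parent) w′-parent)) y-at
  ...   | tri> _ _ r<p = ⊥-elim (noBackward j′<c w′-at y-at (w-forward r<p y-parent w′-parent))

  parent-position-≤ : length (parentsOf G w) ≤ length l → p ≤ j′
  parent-position-≤ short = s≤s⁻¹ (∸-cancelʳ-≤ p<l (≤-trans counted (∸-monoˡ-≤ (suc p) short)))
    where
    p<l : p < length l
    p<l = <-≤-trans (at⇒< (parentsOf G w) w′-parent) short

    counted : length l ∸ suc j′ ≤ length (parentsOf G w) ∸ suc p
    counted = tail-embedding⇒≤ l (parentsOf G w) distinct later-parents-after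

wellLabelled-∷ʳ : ∀ {k G} → WellLabelled k G → (vs : Vec ℕ k) → TransTournamentPath G vs →
                  WellLabelled k (G ++ [ toList vs ])
wellLabelled-∷ʳ {k} {G} wl vs path = record
  { parents-length≤   = length≤
  ; parents-forward   = forward
  ; parents-inherited = inherited
  }
  where
  open WellLabelled wl
  module New = TournamentPath G vs path
  l = toList vs
  G′ = G ++ [ l ]

  length≤ : ∀ u → length (parentsOf G′ u) ≤ k
  length≤ u with parentsOf-∷ʳ G l u
  ... | inj₁ old rewrite old = parents-length≤ u
  ... | inj₂ new rewrite new = ≤-reflexive (length-toList vs)

  forward : ∀ u → ForwardEdges G′ (parentsOf G′ u)
  forward u a<b x-at y-at with parentsOf-∷ʳ G l u
  ... | inj₁ old = edge-++ G [ l ] (parents-forward u a<b (at-subst old x-at) (at-subst old y-at))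
  ... | inj₂ new = edge-++ G [ l ] (New.forward a<b (at-subst new x-at) (at-subst new y-at))

  inherited : LaterParentsInherited G′
  inherited {u} {x = x} a<b x-at y-at with parentsOf-∷ʳ G l u
  ... | inj₁ old =
    let p , p≤b , y-parent = parents-inherited a<b (at-subst old x-at) (at-subst old y-at)
    in  p , p≤b , parentAt-++ G [ l ] y-parent
  ... | inj₂ new =
    let x-at′ = at-subst new x-at
        y-at′ = at-subst new y-at
        p , y-parent = ∈⇒at (New.forward a<b x-at′ y-at′)
        short = subst (length (parentsOf G x) ≤_) (sym (length-toList vs)) (parents-length≤ x)
    in  p
      , parent-position-≤ G l New.distinct New.forward New.noBackward (parents-forward x)
                          a<b x-at′ y-at′ y-parent short
      , parentAt-++ G [ l ] y-parent

wellLabelled : ∀ {k G} → RootedKTree k G → WellLabelled k G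
wellLabelled (base m≤k)       = TransitiveTournament.wellLabelled _ m≤k
wellLabelled (add t vs _ path) = wellLabelled-∷ʳ (wellLabelled t) vs path

proposition5 : (k : ℕ) (G : Graph) → RootedKTree k G →
    (v w w' i i' : ℕ) → i < i' →
    IsParent G i w v → IsParent G i' w' v →
    Σ ℕ λ i'' → (i'' ≤ i') × IsParent G i'' w' w
proposition5 k G t v w w' .(suc j) .(suc j′) (s≤s j<j′) (j , refl , w-at) (j′ , refl , w′-at) =
  let p , p≤j′ , w′-parent = WellLabelled.parents-inherited (wellLabelled t) j<j′ w-at w′-at
  in  suc p , s≤s p≤j′ , p , refl , w′-parent
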